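{- Let $\nu>1$ be an integer and let $C=C(\nu)\in\mathbb{R}^{(\nu+6)\times(\nu+6)}$ be the matrix defined as follows, where $u$ ranges over $\{1,\ldots,\nu+1\}$ and $v$ over $\{1,\ldots,\nu+2\}$: (1) $C_{uv}=\min\{10u+10v-10,\,20u+1,\,20v-9\}$ if $(u,v)\notin\{(\nu,\nu+1),(\nu+1,\nu+1)\}$; (2) $C_{\nu,\nu+1}=20\nu-1$ and $C_{\nu+1,\nu+1}=20\nu+11$; (3) $C_{u,\nu+3}=0$ and $C_{u,\nu+4}=C_{u,\nu+5}=C_{u,\nu+6}=2$; (4) $C_{\nu+2,u}=10u-3$, $C_{\nu+3,u}=11$, $C_{\nu+4,u}=C_{\nu+5,u}=2$, $C_{\nu+6,u}=0$; (5) the submatrix of $C$ with rows and columns $\nu+2,\ldots,\nu+6$ equals $$\begin{pmatrix}0&0&0&0&2\\0&0&2&0&2\\2&2&0&2&2\\0&2&2&0&2\\0&2&2&2&0\end{pmatrix}.$$ Let $\mu\in\{1,\ldots,\nu+1\}$. Then the matrix $C'$ obtained from $C(\nu)$ by removing its $\mu$th column has factor rank at most $4$.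
   Context: The tropical semiring is $\mathbb{R}$ with $a\oplus b=\min\{a,b\}$ and $a\otimes b=a+b$; $(B\otimes C)_{ij}=\min_{\tau}\{B_{i\tau}+C_{\tau j}\}$. The factor rank of $A\in\mathbb{R}^{m\times n}$ is the smallest $k$ such that $A=B\otimes C$ for some $B\in\mathbb{R}^{m\times k}$, $C\in\mathbb{R}^{k\times n}$. -}

module Defs where

open import Data.Nat as ℕ using (ℕ; zero; suc; _+_; _*_; _∸_; _≤_; _<_; _≤ᵇ_; _≡ᵇ_)
open import Data.Bool using (Bool; if_then_else_; _∧_)
open import Data.Fin using (Fin; zero; suc; toℕ; punchIn)
open import Data.Integer using (+_)
open import Data.Rational using (ℚ; _/_; _⊓_)
open import Data.Product using (Σ; _×_; ∃-syntax)
open import Relation.Binary.PropositionalEquality using (_≡_)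

-- Real matrices are represented with rational entries.
Mat : ℕ → ℕ → Set
Mat m n = Fin m → Fin n → ℚ

minF : ∀ k → (Fin (suc k) → ℚ) → ℚ
minF zero    f = f zero
minF (suc k) f = f zero ⊓ minF k (λ t → f (suc t))

_⊗_ : ∀ {m k n} → Mat m (suc k) → Mat (suc k) n → Mat m n
_⊗_ {k = k} B D i j = minF k (λ τ → B i τ Data.Rational.+ D τ j)

HasFactorization : ∀ {m n} → (k : ℕ) → Mat m n → Set
HasFactorization {m} {n} zero    A = Data.Empty.⊥ where import Data.Empty
HasFactorization {m} {n} (suc k) A =
  Σ (Mat m (suc k)) λ B → Σ (Mat (suc k) n) λ D → ∀ i j → A i j ≡ (B ⊗ D) i j

-- factor rank ≤ r : the minimal k admitting a factorization is ≤ r,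
-- i.e. some k ≤ r admits a factorization
FactorRankAtMost : ∀ {m n} → ℕ → Mat m n → Set
FactorRankAtMost r A = ∃[ k ] (k ≤ r × HasFactorization k A)

-- the 5×5 block of rows/columns ν+2..ν+6 (0-based offsets)
blk : ℕ → ℕ → ℕ
blk 0 4 = 2
blk 0 _ = 0
blk 1 2 = 2
blk 1 4 = 2
blk 1 _ = 0
blk 2 2 = 0
blk 2 _ = 2
blk 3 0 = 0
blk 3 3 = 0
blk 3 _ = 2
blk _ 0 = 0
blk _ 4 = 0
blk _ _ = 2

-- rows ν+2..ν+6 (offset d = 0..4), columns v ∈ {1..ν+1}
lowRow : ℕ → ℕ → ℕ
lowRow 0 v = 10 * v ∸ 3
lowRow 1 v = 11
lowRow 4 v = 0
lowRow _ v = 2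

-- entry C(ν)_{uv} with 1-based indices u, v ∈ {1, …, ν+6}
Centry : ℕ → ℕ → ℕ → ℕ
Centry ν u v =
  if u ≤ᵇ ν + 1
  then (if v ≤ᵇ ν + 2
        then (if (u ≡ᵇ ν) ∧ (v ≡ᵇ ν + 1) then 20 * ν ∸ 1
              else if (u ≡ᵇ ν + 1) ∧ (v ≡ᵇ ν + 1) then 20 * ν + 11
              else ((10 * u + 10 * v ∸ 10) ℕ.⊓ (20 * u + 1)) ℕ.⊓ (20 * v ∸ 9))
        else if v ≡ᵇ ν + 3 then 0 else 2)
  else (if v ≤ᵇ ν + 1
        then lowRow (u ∸ (ν + 2)) v
        else blk (u ∸ (ν + 2)) (v ∸ (ν + 2)))

C : (ν : ℕ) → Mat (6 + ν) (6 + ν)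
C ν i j = (+ Centry ν (suc (toℕ i)) (suc (toℕ j))) / 1

removeCol : ∀ {m n} → Fin (suc n) → Mat m (suc n) → Mat m n
removeCol c A i j = A i (punchIn c j)

-- An explicit factorisation C' = B ⊗ D with four columns. In the top-left block (u ≤ ν+1, v ≤ ν+2)
-- columns 1 and 2 of B ⊗ D reproduce the terms 20u+1 and 20v-9, column 3 never undercuts them, and
-- column 0 contributes B(u,0) + D(0,v) with B(u,0) = 10u-7 or 10u-8 as u < μ or u ≥ μ, and
-- D(0,v) = 10v-3 or 10v-2 as v < μ or v > μ. This is the band term 10u+10v-10 unless u and v lie on
-- opposite sides of μ, and then (v = μ being excluded) |u - v| is large enough that the band term is not
-- the minimum anyway. Row and column ν+1, which carry the two exceptional entries, and the last five
-- rows and columns are matched by a few more entries of B and D, with a large value standing in for +∞.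
module Submission where

open import Defs
open import Data.Bool using (true; false; T)
open import Data.Bool.Properties using (∧-zeroʳ; T-≡)
open import Data.Empty using (⊥-elim)
open import Data.Fin using (Fin; zero; suc; toℕ; fromℕ<; punchIn)
open import Data.Fin.Properties using (toℕ<n; toℕ-fromℕ<; toℕ-injective; punchInᵢ≢i; all?)
open import Data.Integer as ℤ using (+_)
import Data.Integer.Properties as ℤ
open import Data.Nat
  using ( ℕ; zero; suc; _+_; _*_; _∸_; _⊓_; _≤_; _<_; _≤ᵇ_; _≡ᵇ_; z≤n; s≤s; s≤s⁻¹
        ; _<?_; _≤?_; _≟_)
open import Data.Nat.Coprimality using (1-coprimeTo) renaming (sym to coprime-sym)
open import Data.Nat.Properties
open import Data.Nat.Tactic.RingSolver using (solve-∀)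
open import Data.Product using (Σ; _,_)
open import Data.Rational as ℚ using (ℚ; mkℚ; _/_)
import Data.Rational.Properties as ℚ
open import Data.Sum using (inj₁; inj₂)
open import Function using (_∘_; Equivalence)
open import Relation.Nullary using (¬_; yes; no)
open import Relation.Nullary.Decidable using (True; toWitness)
open import Relation.Binary.Definitions using (tri<; tri≈; tri>)
open import Relation.Binary.PropositionalEquality
  using (_≡_; _≢_; refl; sym; trans; cong; cong₂; subst; subst₂; module ≡-Reasoning)

toℚ : ℕ → ℚ
toℚ n = + n / 1

toℚ-normal : ∀ n → toℚ n ≡ mkℚ (+ n) 0 (coprime-sym (1-coprimeTo n))
toℚ-normal n = ℚ.normalize-coprime (coprime-sym (1-coprimeTo n))

toℚ-+ : ∀ m n → toℚ (m + n) ≡ toℚ m ℚ.+ toℚ n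
toℚ-+ m n rewrite toℚ-normal m | toℚ-normal n =
  sym (cong (_/ 1) (cong₂ ℤ._+_ (ℤ.*-identityʳ (+ m)) (ℤ.*-identityʳ (+ n))))

toℚ-mono-≤ : ∀ {m n} → m ≤ n → toℚ m ℚ.≤ toℚ n
toℚ-mono-≤ {m} {n} m≤n rewrite toℚ-normal m | toℚ-normal n =
  ℚ.*≤* (subst₂ ℤ._≤_ (sym (ℤ.*-identityʳ (+ m))) (sym (ℤ.*-identityʳ (+ n))) (ℤ.+≤+ m≤n))

toℚ-⊓ : ∀ m n → toℚ (m ⊓ n) ≡ toℚ m ℚ.⊓ toℚ n
toℚ-⊓ m n with ≤-total m n
... | inj₁ m≤n =
  trans (cong toℚ (m≤n⇒m⊓n≡m m≤n)) (sym (ℚ.p≤q⇒p⊓q≡p (toℚ-mono-≤ m≤n)))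
... | inj₂ n≤m =
  trans (cong toℚ (m≥n⇒m⊓n≡n n≤m)) (sym (ℚ.p≥q⇒p⊓q≡q (toℚ-mono-≤ n≤m)))

⨅ : ∀ {k} → (Fin (suc k) → ℕ) → ℕ
⨅ {zero}  f = f zero
⨅ {suc k} f = f zero ⊓ ⨅ (λ τ → f (suc τ))

⨅-≤ : ∀ {k} (f : Fin (suc k) → ℕ) τ → ⨅ f ≤ f τ
⨅-≤ {zero}  f zero    = ≤-refl
⨅-≤ {suc k} f zero    = m⊓n≤m _ _
⨅-≤ {suc k} f (suc τ) = ≤-trans (m⊓n≤n _ _) (⨅-≤ (λ τ → f (suc τ)) τ)

≤-⨅ : ∀ {k} (f : Fin (suc k) → ℕ) {x} → (∀ τ → x ≤ f τ) → x ≤ ⨅ f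
≤-⨅ {zero}  f x≤f = x≤f zero
≤-⨅ {suc k} f x≤f = ⊓-glb (x≤f zero) (≤-⨅ (λ τ → f (suc τ)) (λ τ → x≤f (suc τ)))

⨅-attained : ∀ {k} (f : Fin (suc k) → ℕ) {x} →
  (∀ τ → x ≤ f τ) → ∀ τ → f τ ≡ x → ⨅ f ≡ x
⨅-attained f x≤f τ refl = ≤-antisym (⨅-≤ f τ) (≤-⨅ f x≤f)

_⊙_ : ∀ {k} → (Fin (suc k) → ℕ) → (Fin (suc k) → ℕ) → ℕ
u ⊙ v = ⨅ (λ τ → u τ + v τ)

-- The lower bounds are decided by evaluation, which goes through despite free variables as long as
-- each sum u τ + v τ is either a numeral or starts with more `suc`s than x.
⊙-attained-by-computation : ∀ {k} (u v : Fin (suc k) → ℕ) {x} τ → u τ + v τ ≡ x →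
  {True (all? λ τ → x ≤? u τ + v τ)} → u ⊙ v ≡ x
⊙-attained-by-computation u v {x} τ uτ+vτ≡x {bounds} =
  ⨅-attained (λ τ → u τ + v τ) (toWitness {a? = all? λ τ → x ≤? u τ + v τ} bounds)
             τ uτ+vτ≡x

toℚ-⊙ : ∀ k (u v : Fin (suc k) → ℕ) →
  toℚ (u ⊙ v) ≡ minF k (λ τ → toℚ (u τ) ℚ.+ toℚ (v τ))
toℚ-⊙ zero    u v = toℚ-+ (u zero) (v zero)
toℚ-⊙ (suc k) u v =
  trans (toℚ-⊓ (u zero + v zero) ((λ τ → u (suc τ)) ⊙ (λ τ → v (suc τ))))
        (cong₂ ℚ._⊓_ (toℚ-+ (u zero) (v zero))
                     (toℚ-⊙ k (λ τ → u (suc τ)) (λ τ → v (suc τ))))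

tropical-factorization : ∀ {m n k} (A : Fin m → Fin n → ℕ)
  (row : Fin m → Fin (suc k) → ℕ) (col : Fin n → Fin (suc k) → ℕ) →
  (∀ i j → A i j ≡ row i ⊙ col j) → HasFactorization (suc k) (λ i j → toℚ (A i j))
tropical-factorization {k = k} A row col A≡ =
  (λ i τ → toℚ (row i τ)) , (λ τ j → toℚ (col j τ)) ,
  λ i j → trans (cong toℚ (A≡ i j)) (toℚ-⊙ k (row i) (col j))

¬T⇒≡false : ∀ {b} → ¬ T b → b ≡ false
¬T⇒≡false {false} _  = refl
¬T⇒≡false {true}  ¬t = ⊥-elim (¬t _)

≤ᵇ-true : ∀ {m n} → m ≤ n → (m ≤ᵇ n) ≡ true
≤ᵇ-true m≤n = Equivalence.to T-≡ (≤⇒≤ᵇ m≤n)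

≤ᵇ-false : ∀ {m n} → n < m → (m ≤ᵇ n) ≡ false
≤ᵇ-false {m} {n} n<m = ¬T⇒≡false (λ t → <⇒≱ n<m (≤ᵇ⇒≤ m n t))

≡ᵇ-true : ∀ m → (m ≡ᵇ m) ≡ true
≡ᵇ-true m = Equivalence.to T-≡ (≡⇒≡ᵇ m m refl)

≡ᵇ-false : ∀ {m n} → m ≢ n → (m ≡ᵇ n) ≡ false
≡ᵇ-false {m} {n} m≢n = ¬T⇒≡false (λ t → m≢n (≡ᵇ⇒≡ m n t))

∸-by : ∀ x k y → x ≡ k + y → x ∸ k ≡ y
∸-by _ k y refl = m+n∸m≡n k y

-- With 0-based indices r = u - 1, c = v - 1, the three terms 10u+10v-10, 20u+1, 20v-9
diagTerm : ℕ → ℕ → ℕ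
diagTerm r c = 10 + 10 * r + 10 * c

rowTerm colTerm : ℕ → ℕ
rowTerm r = 21 + 20 * r
colTerm c = 11 + 20 * c

topEntry : ℕ → ℕ → ℕ
topEntry r c = diagTerm r c ⊓ (rowTerm r ⊓ colTerm c)

topFormula : ∀ r c →
  ((10 * suc r + 10 * suc c ∸ 10) ⊓ (20 * suc r + 1)) ⊓ (20 * suc c ∸ 9) ≡ topEntry r c
topFormula r c = trans
  (cong₂ _⊓_ (cong₂ _⊓_ (∸-by _ 10 (diagTerm r c) (diag r c)) (row r))
             (∸-by _ 9 (colTerm c) (col c)))
  (⊓-assoc (diagTerm r c) (rowTerm r) (colTerm c))
  where
  diag : ∀ r c → 10 * suc r + 10 * suc c ≡ 10 + (10 + 10 * r + 10 * c)
  diag = solve-∀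
  row : ∀ r → 20 * suc r + 1 ≡ 21 + 20 * r
  row = solve-∀
  col : ∀ c → 20 * suc c ≡ 9 + (11 + 20 * c)
  col = solve-∀

Centry-topBlock : ∀ {ν r c} → r ≤ ν → c ≤ suc ν → c ≢ ν →
  Centry ν (suc r) (suc c) ≡ topEntry r c
Centry-topBlock {ν} {r} {c} r≤ν c≤1+ν c≢ν
  rewrite +-comm ν 1 | +-comm ν 2
        | ≤ᵇ-true (s≤s r≤ν) | ≤ᵇ-true (s≤s c≤1+ν) | ≡ᵇ-false c≢ν
        | ∧-zeroʳ (suc r ≡ᵇ ν) | ∧-zeroʳ (r ≡ᵇ ν)
        = topFormula r c

Centry-top : ∀ {ν r c} → r ≤ ν → c < ν → Centry ν (suc r) (suc c) ≡ topEntry r c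
Centry-top r≤ν c<ν = Centry-topBlock r≤ν (≤-trans (<⇒≤ c<ν) (n≤1+n _)) (<⇒≢ c<ν)

Centry-top-right₀ : ∀ {ν r} → r ≤ ν → Centry ν (suc r) (2 + ν) ≡ topEntry r (suc ν)
Centry-top-right₀ r≤ν = Centry-topBlock r≤ν ≤-refl 1+n≢n

Centry-top-lastCol : ∀ {ν r} → suc r < ν → Centry ν (suc r) (suc ν) ≡ topEntry r ν
Centry-top-lastCol {ν} {r} 2+r≤ν
  rewrite +-comm ν 1 | +-comm ν 2
        | ≤ᵇ-true (s≤s (<⇒≤ (<-trans (n<1+n r) 2+r≤ν))) | ≤ᵇ-true (n≤1+n (suc ν))
        | ≡ᵇ-false (<⇒≢ 2+r≤ν) | ≡ᵇ-false (<⇒≢ (<-trans (n<1+n r) 2+r≤ν))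
        = topFormula r ν

Centry-penultimate : ∀ n → Centry (suc n) (suc n) (suc (suc n)) ≡ 19 + 20 * n
Centry-penultimate n
  rewrite +-comm n 1 | +-comm n 2
        | ≤ᵇ-true (n≤1+n (suc n)) | ≡ᵇ-true n
        = ∸-by (20 * suc n) 1 (19 + 20 * n) (20+20n n)
  where
  20+20n : ∀ n → 20 * suc n ≡ 1 + (19 + 20 * n)
  20+20n = solve-∀

Centry-last-last : ∀ ν → Centry ν (suc ν) (suc ν) ≡ colTerm ν
Centry-last-last ν
  rewrite +-comm ν 1 | +-comm ν 2
        | ≤ᵇ-true (≤-refl {suc ν}) | ≤ᵇ-true (n≤1+n (suc ν))
        | ≡ᵇ-false {suc ν} {ν} 1+n≢n | ≡ᵇ-true ν
        = +-comm (20 * ν) 11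

Centry-top-right₁ : ∀ {ν r} → r ≤ ν → Centry ν (suc r) (3 + ν) ≡ 0
Centry-top-right₁ {ν} {r} r≤ν
  rewrite +-comm ν 1 | +-comm ν 2 | +-comm ν 3
        | ≤ᵇ-true (s≤s r≤ν) | ≤ᵇ-false {3 + ν} {2 + ν} ≤-refl | ≡ᵇ-true ν
        = refl

Centry-top-right₂ : ∀ {ν r} m → r ≤ ν → Centry ν (suc r) (3 + (m + suc ν)) ≡ 2
Centry-top-right₂ {ν} {r} m r≤ν
  rewrite +-comm ν 1 | +-comm ν 2 | +-comm ν 3
        | ≤ᵇ-true (s≤s r≤ν)
        | ≤ᵇ-false {3 + (m + suc ν)} {2 + ν}
                   (s≤s (s≤s (s≤s (≤-trans (n≤1+n ν) (m≤n+m (suc ν) m)))))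
        | ≡ᵇ-false {m + suc ν} {ν} (λ eq → <⇒≢ (m≤n+m (suc ν) m) (sym eq))
        = refl

Centry-lower-top : ∀ {ν c} d → c ≤ ν → Centry ν (suc (d + suc ν)) (suc c) ≡ lowRow d (suc c)
Centry-lower-top {ν} {c} d c≤ν
  rewrite +-comm ν 1 | +-comm ν 2
        | ≤ᵇ-false {suc (d + suc ν)} {suc ν} (s≤s (m≤n+m (suc ν) d)) | ≤ᵇ-true (s≤s c≤ν)
        = cong (λ x → lowRow x (suc c)) (m+n∸n≡m d (suc ν))

Centry-lower-right : ∀ {ν} d k → Centry ν (suc (d + suc ν)) (suc (k + suc ν)) ≡ blk d k
Centry-lower-right {ν} d k
  rewrite +-comm ν 1 | +-comm ν 2
        | ≤ᵇ-false {suc (d + suc ν)} {suc ν} (s≤s (m≤n+m (suc ν) d))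
        | ≤ᵇ-false {suc (k + suc ν)} {suc ν} (s≤s (m≤n+m (suc ν) k))
        = cong₂ blk (m+n∸n≡m d (suc ν)) (m+n∸n≡m k (suc ν))

⟨_,_,_,_⟩ : ℕ → ℕ → ℕ → ℕ → Fin 4 → ℕ
⟨ x , y , z , w ⟩ zero                   = x
⟨ x , y , z , w ⟩ (suc zero)             = y
⟨ x , y , z , w ⟩ (suc (suc zero))       = z
⟨ x , y , z , w ⟩ (suc (suc (suc zero))) = w

topRow : ℕ → ℕ → Fin 4 → ℕ
topRow a r = ⟨ a , rowTerm r , 0 , rowTerm r ⟩

topCol : ℕ → ℕ → ℕ → Fin 4 → ℕ
topCol b c e = ⟨ b , 0 , colTerm c , e ⟩

-- plays the role of +∞: it exceeds every entry of C(ν) it is compared with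
big : ℕ → ℕ
big ν = 11 + 10 * ν

lowerRow : ℕ → Fin 5 → Fin 4 → ℕ
lowerRow ν zero                         = ⟨ 0     , big ν , 0     , 0     ⟩
lowerRow ν (suc zero)                   = ⟨ big ν , 11    , 0     , 0     ⟩
lowerRow ν (suc (suc zero))             = ⟨ 0     , 2     , 2     , big ν ⟩
lowerRow ν (suc (suc (suc zero)))       = ⟨ 2     , 2     , 2     , 0     ⟩
lowerRow ν (suc (suc (suc (suc zero)))) = ⟨ big ν , 0     , big ν , big ν ⟩

rightCol : ℕ → Fin 5 → Fin 4 → ℕ
rightCol ν zero                         = topCol (9 + 10 * ν) (suc ν) 0
rightCol ν (suc zero)                   = ⟨ 2 , 2 , 0 , 2 ⟩
rightCol ν (suc (suc zero))             = ⟨ 0 , 2 , 2 , 2 ⟩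
rightCol ν (suc (suc (suc zero)))       = ⟨ 2 , 2 , 2 , 0 ⟩
rightCol ν (suc (suc (suc (suc zero)))) = ⟨ 2 , 0 , 2 , 2 ⟩

-- Indices are 0-based; lower d and right k are the last five rows and columns.
data RowBlock (ν μ : ℕ) : ℕ → Set where
  before : ∀ {r} → r < μ → RowBlock ν μ r
  after  : ∀ {r} → μ ≤ r → r < ν → RowBlock ν μ r
  last   : RowBlock ν μ ν
  lower  : (d : Fin 5) → RowBlock ν μ (toℕ d + suc ν)

data ColBlock (ν μ : ℕ) : ℕ → Set where
  before : ∀ {c} → c < μ → ColBlock ν μ c
  after  : ∀ {c} → μ < c → c < ν → ColBlock ν μ c
  last   : μ < ν → ColBlock ν μ ν
  right  : (k : Fin 5) → ColBlock ν μ (toℕ k + suc ν)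

rowVector : ∀ {ν μ r} → RowBlock ν μ r → Fin 4 → ℕ
rowVector     (before {r} _)  = topRow (3 + 10 * r) r
rowVector     (after {r} _ _) = topRow (2 + 10 * r) r
rowVector {ν} last            = topRow (11 + 10 * ν) ν
rowVector {ν} (lower d)       = lowerRow ν d

colVector : ∀ {ν μ c} → ColBlock ν μ c → Fin 4 → ℕ
colVector     (before {c} _)  = topCol (7 + 10 * c) c (colTerm c)
colVector     (after {c} _ _) = topCol (8 + 10 * c) c (7 + 10 * c)
colVector {ν} (last _)        = topCol (7 + 10 * ν) ν (colTerm ν)
colVector {ν} (right k)       = rightCol ν k

lowerOffset : ∀ {ν x} → ν < x → x < 6 + ν → Σ (Fin 5) λ d → toℕ d + suc ν ≡ x
lowerOffset {ν} {x} ν<x x<6+ν =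
  fromℕ< x∸1+ν<5 , trans (cong (_+ suc ν) (toℕ-fromℕ< x∸1+ν<5)) (m∸n+n≡m ν<x)
  where
  x∸1+ν<5 : x ∸ suc ν < 5
  x∸1+ν<5 = m<n+o⇒m∸n<o x (suc ν) (subst (x <_) (cong suc (+-comm 5 ν)) x<6+ν)

rowBlock : ∀ ν μ r → r < 6 + ν → RowBlock ν μ r
rowBlock ν μ r r<6+ν with r <? μ
... | yes r<μ = before r<μ
... | no r≮μ with <-cmp r ν
...   | tri< r<ν _ _ = after (≮⇒≥ r≮μ) r<ν
...   | tri≈ _ refl _ = last
...   | tri> _ _ ν<r with lowerOffset ν<r r<6+ν
...     | d , refl = lower d

colBlock : ∀ ν μ c → c < 6 + ν → c ≢ μ → ColBlock ν μ c
colBlock ν μ c c<6+ν c≢μ with c <? μ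
... | yes c<μ = before c<μ
... | no c≮μ with <-cmp c ν
...   | tri< c<ν _ _ = after μ<c c<ν where μ<c = ≤∧≢⇒< (≮⇒≥ c≮μ) (c≢μ ∘ sym)
...   | tri≈ _ refl _ = last (≤∧≢⇒< (≮⇒≥ c≮μ) (c≢μ ∘ sym))
...   | tri> _ _ ν<c with lowerOffset ν<c c<6+ν
...     | k , refl = right k

rowTerm≤ : ∀ a b s {r c} → 21 ≤ a + b + 10 * s → s + r ≤ c →
  rowTerm r ≤ (a + 10 * r) + (b + 10 * c)
rowTerm≤ a b s {r} 21≤ s+r≤c with m≤n⇒∃[o]m+o≡n s+r≤c
... | k , refl = begin
  rowTerm r                             ≤⟨ +-monoˡ-≤ (20 * r) 21≤ ⟩
  a + b + 10 * s + 20 * r               ≤⟨ m≤m+n _ (10 * k) ⟩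
  a + b + 10 * s + 20 * r + 10 * k      ≡⟨ regroup a b s r k ⟩
  (a + 10 * r) + (b + 10 * (s + r + k)) ∎
  where
  open ≤-Reasoning
  regroup : ∀ a b s r k → a + b + 10 * s + 20 * r + 10 * k ≡ (a + 10 * r) + (b + 10 * (s + r + k))
  regroup = solve-∀

colTerm≤ : ∀ a b s {r c} → 11 ≤ a + b + 10 * s → s + c ≤ r →
  colTerm c ≤ (a + 10 * r) + (b + 10 * c)
colTerm≤ a b s {c = c} 11≤ s+c≤r with m≤n⇒∃[o]m+o≡n s+c≤r
... | k , refl = begin
  colTerm c                             ≤⟨ +-monoˡ-≤ (20 * c) 11≤ ⟩
  a + b + 10 * s + 20 * c               ≤⟨ m≤m+n _ (10 * k) ⟩
  a + b + 10 * s + 20 * c + 10 * k      ≡⟨ regroup a b s c k ⟩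
  (a + 10 * (s + c + k)) + (b + 10 * c) ∎
  where
  open ≤-Reasoning
  regroup : ∀ a b s c k → a + b + 10 * s + 20 * c + 10 * k ≡ (a + 10 * (s + c + k)) + (b + 10 * c)
  regroup = solve-∀

diag-split : ∀ a b r c → a + b ≡ 10 → (a + 10 * r) + (b + 10 * c) ≡ diagTerm r c
diag-split a b r c a+b≡10 = trans (regroup a b r c) (cong (λ t → t + 10 * r + 10 * c) a+b≡10)
  where
  regroup : ∀ a b r c → (a + 10 * r) + (b + 10 * c) ≡ a + b + 10 * r + 10 * c
  regroup = solve-∀

topRow⊙topCol : ∀ a r b c e → topRow a r ⊙ topCol b c e ≡ (a + b) ⊓ (rowTerm r ⊓ colTerm c)
topRow⊙topCol a r b c e = cong ((a + b) ⊓_) (begin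
  (R + 0) ⊓ (K ⊓ (R + e))  ≡⟨ cong₂ _⊓_ (+-identityʳ R) (⊓-comm K (R + e)) ⟩
  R ⊓ ((R + e) ⊓ K)        ≡⟨ ⊓-assoc R (R + e) K ⟨
  (R ⊓ (R + e)) ⊓ K        ≡⟨ cong (_⊓ K) (m≤n⇒m⊓n≡m (m≤m+n R e)) ⟩
  R ⊓ K                    ∎)
  where
  open ≡-Reasoning
  R = rowTerm r
  K = colTerm c

⊓-agree : ∀ {x a b} → x ≤ a → x ≤ b → a ⊓ x ≡ b ⊓ x
⊓-agree x≤a x≤b = trans (m≥n⇒m⊓n≡n x≤a) (sym (m≥n⇒m⊓n≡n x≤b))

last-right₀ : ∀ ν → 11 + 10 * ν + (9 + 10 * ν) ≡ diagTerm ν (suc ν)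
last-right₀ ν = regroup ν
  where
  regroup : ∀ ν → 11 + 10 * ν + (9 + 10 * ν) ≡ 10 + 10 * ν + 10 * suc ν
  regroup = solve-∀

band-exact : ∀ a r b c {e} → a + b ≡ diagTerm r c → topEntry r c ≡ topRow a r ⊙ topCol b c e
band-exact a r b c {e} a+b≡ =
  trans (cong (_⊓ (rowTerm r ⊓ colTerm c)) (sym a+b≡)) (sym (topRow⊙topCol a r b c e))

band-rowTerm : ∀ a r b c {e} → suc r < c → rowTerm r ≤ a + b →
  topEntry r c ≡ topRow a r ⊙ topCol b c e
band-rowTerm a r b c {e} 2+r≤c R≤a+b = trans
  (⊓-agree (≤-trans (m⊓n≤m _ _) (rowTerm≤ 10 0 2 (≤ᵇ⇒≤ 21 30 _) 2+r≤c))
           (≤-trans (m⊓n≤m _ _) R≤a+b))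
  (sym (topRow⊙topCol a r b c e))

band-colTerm : ∀ a r b c {e} → c < r → colTerm c ≤ a + b →
  topEntry r c ≡ topRow a r ⊙ topCol b c e
band-colTerm a r b c {e} c<r K≤a+b = trans
  (⊓-agree (≤-trans (m⊓n≤n _ _) (colTerm≤ 10 0 1 (≤ᵇ⇒≤ 11 20 _) c<r))
           (≤-trans (m⊓n≤n _ _) K≤a+b))
  (sym (topRow⊙topCol a r b c e))

penultimate-entry : ∀ n → Centry (suc n) (suc n) (suc (suc n)) ≡
  topRow (2 + 10 * n) n ⊙ topCol (7 + 10 * suc n) (suc n) (colTerm (suc n))
penultimate-entry n = begin
  Centry (suc n) (suc n) (suc (suc n))
    ≡⟨ Centry-penultimate n ⟩
  19 + 20 * n
    ≡⟨ m≤n⇒m⊓n≡m (⊓-glb 19≤R 19≤K) ⟨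
  (19 + 20 * n) ⊓ X
    ≡⟨ cong (_⊓ X) (s0≡ n) ⟨
  (2 + 10 * n + (7 + 10 * suc n)) ⊓ X
    ≡⟨ topRow⊙topCol (2 + 10 * n) n (7 + 10 * suc n) (suc n) (colTerm (suc n)) ⟨
  topRow (2 + 10 * n) n ⊙ topCol (7 + 10 * suc n) (suc n) (colTerm (suc n)) ∎
  where
  open ≡-Reasoning
  X = rowTerm n ⊓ colTerm (suc n)
  s0≡ : ∀ n → 2 + 10 * n + (7 + 10 * suc n) ≡ 19 + 20 * n
  s0≡ = solve-∀
  K≡ : ∀ n → 19 + 20 * n + 12 ≡ 11 + 20 * suc n
  K≡ = solve-∀
  19≤R : 19 + 20 * n ≤ rowTerm n
  19≤R = +-monoˡ-≤ (20 * n) (≤ᵇ⇒≤ 19 21 _)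
  19≤K : 19 + 20 * n ≤ colTerm (suc n)
  19≤K = ≤-trans (m≤m+n _ 12) (≤-reflexive (K≡ n))

last-last-entry : ∀ ν →
  Centry ν (suc ν) (suc ν) ≡ topRow (11 + 10 * ν) ν ⊙ topCol (7 + 10 * ν) ν (colTerm ν)
last-last-entry ν = begin
  Centry ν (suc ν) (suc ν)
    ≡⟨ Centry-last-last ν ⟩
  colTerm ν
    ≡⟨ m≥n⇒m⊓n≡n K≤s0 ⟨
  s0 ⊓ colTerm ν
    ≡⟨ cong (s0 ⊓_) (m≥n⇒m⊓n≡n K≤R) ⟨
  s0 ⊓ (rowTerm ν ⊓ colTerm ν)
    ≡⟨ topRow⊙topCol (11 + 10 * ν) ν (7 + 10 * ν) ν (colTerm ν) ⟨
  topRow (11 + 10 * ν) ν ⊙ topCol (7 + 10 * ν) ν (colTerm ν) ∎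
  where
  open ≡-Reasoning
  s0 = 11 + 10 * ν + (7 + 10 * ν)
  s0≡ : ∀ ν → 11 + 20 * ν + 7 ≡ 11 + 10 * ν + (7 + 10 * ν)
  s0≡ = solve-∀
  K≤s0 : colTerm ν ≤ s0
  K≤s0 = ≤-trans (m≤m+n _ 7) (≤-reflexive (s0≡ ν))
  K≤R : colTerm ν ≤ rowTerm ν
  K≤R = +-monoˡ-≤ (20 * ν) (≤ᵇ⇒≤ 11 21 _)

top-right : ∀ {ν r} a → r ≤ ν → (k : Fin 4) →
  Centry ν (suc r) (suc (toℕ (suc k) + suc ν)) ≡ topRow (2 + a) r ⊙ rightCol ν (suc k)
top-right {ν} {r} a r≤ν k = trans (entry k) (sym (product k))
  where
  row = topRow (2 + a) r
  value : Fin 4 → ℕ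
  value zero    = 0
  value (suc _) = 2
  entry : ∀ k → Centry ν (suc r) (suc (toℕ (suc k) + suc ν)) ≡ value k
  entry zero                   = Centry-top-right₁ r≤ν
  entry (suc zero)             = Centry-top-right₂ 0 r≤ν
  entry (suc (suc zero))       = Centry-top-right₂ 1 r≤ν
  entry (suc (suc (suc zero))) = Centry-top-right₂ 2 r≤ν
  product : ∀ k → row ⊙ rightCol ν (suc k) ≡ value k
  product k@zero                   = ⊙-attained-by-computation row (rightCol ν (suc k)) (suc (suc zero)) refl
  product k@(suc zero)             = ⊙-attained-by-computation row (rightCol ν (suc k)) (suc (suc zero)) refl
  product k@(suc (suc zero))       = ⊙-attained-by-computation row (rightCol ν (suc k)) (suc (suc zero)) refl
  product k@(suc (suc (suc zero))) = ⊙-attained-by-computation row (rightCol ν (suc k)) (suc (suc zero)) refl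

low≤big : ∀ {ν c} → c ≤ ν → 7 + 10 * c ≤ big ν + 0
low≤big {ν} c≤ν =
  ≤-trans (+-mono-≤ (≤ᵇ⇒≤ 7 11 _) (*-monoʳ-≤ 10 c≤ν)) (m≤m+n (big ν) 0)

low≤colTerm : ∀ c → 7 + 10 * c ≤ colTerm c
low≤colTerm c = +-mono-≤ (≤ᵇ⇒≤ 7 11 _) (*-monoˡ-≤ c (≤ᵇ⇒≤ 10 20 _))

lowRow₀ : ∀ c → lowRow 0 (suc c) ≡ 7 + 10 * c
lowRow₀ c = ∸-by (10 * suc c) 3 (7 + 10 * c) (10+10c c)
  where
  10+10c : ∀ c → 10 * suc c ≡ 3 + (7 + 10 * c)
  10+10c = solve-∀

lower-nearCol : ∀ {ν c} (d : Fin 5) → c ≤ ν →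
  Centry ν (suc (toℕ d + suc ν)) (suc c) ≡ lowerRow ν d ⊙ topCol (7 + 10 * c) c (colTerm c)
lower-nearCol {ν} {c} d c≤ν = trans (Centry-lower-top (toℕ d) c≤ν) (sym (product d))
  where
  col = topCol (7 + 10 * c) c (colTerm c)
  bound₀ : ∀ τ → 7 + 10 * c ≤ lowerRow ν zero τ + col τ
  bound₀ zero                   = ≤-refl
  bound₀ (suc zero)             = low≤big c≤ν
  bound₀ (suc (suc zero))       = low≤colTerm c
  bound₀ (suc (suc (suc zero))) = low≤colTerm c
  product : ∀ d → lowerRow ν d ⊙ col ≡ lowRow (toℕ d) (suc c)
  product zero = trans (⨅-attained _ bound₀ zero refl) (sym (lowRow₀ c))
  product d@(suc zero)                   = ⊙-attained-by-computation (lowerRow ν d) col (suc zero) refl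
  product d@(suc (suc zero))             = ⊙-attained-by-computation (lowerRow ν d) col (suc zero) refl
  product d@(suc (suc (suc zero)))       = ⊙-attained-by-computation (lowerRow ν d) col (suc zero) refl
  product d@(suc (suc (suc (suc zero)))) = ⊙-attained-by-computation (lowerRow ν d) col (suc zero) refl

lower-afterCol : ∀ {ν c} (d : Fin 5) → 0 < c → c ≤ ν →
  Centry ν (suc (toℕ d + suc ν)) (suc c) ≡ lowerRow ν d ⊙ topCol (8 + 10 * c) c (7 + 10 * c)
lower-afterCol {ν} {c} d 0<c c≤ν = trans (Centry-lower-top (toℕ d) c≤ν) (sym (product d))
  where
  col = topCol (8 + 10 * c) c (7 + 10 * c)
  bound₀ : ∀ τ → 7 + 10 * c ≤ lowerRow ν zero τ + col τ
  bound₀ zero                   = n≤1+n _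
  bound₀ (suc zero)             = low≤big c≤ν
  bound₀ (suc (suc zero))       = low≤colTerm c
  bound₀ (suc (suc (suc zero))) = ≤-refl
  bound₁ : ∀ τ → 11 ≤ lowerRow ν (suc zero) τ + col τ
  bound₁ zero                   = m≤m+n 11 _
  bound₁ (suc zero)             = ≤-refl
  bound₁ (suc (suc zero))       = m≤m+n 11 _
  bound₁ (suc (suc (suc zero))) = ≤-trans (≤ᵇ⇒≤ 11 17 _) (+-monoʳ-≤ 7 (*-monoʳ-≤ 10 0<c))
  product : ∀ d → lowerRow ν d ⊙ col ≡ lowRow (toℕ d) (suc c)
  product zero       = trans (⨅-attained _ bound₀ (suc (suc (suc zero))) refl) (sym (lowRow₀ c))
  product (suc zero) = ⨅-attained _ bound₁ (suc zero) refl
  product d@(suc (suc zero))             = ⊙-attained-by-computation (lowerRow ν d) col (suc zero) refl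
  product d@(suc (suc (suc zero)))       = ⊙-attained-by-computation (lowerRow ν d) col (suc zero) refl
  product d@(suc (suc (suc (suc zero)))) = ⊙-attained-by-computation (lowerRow ν d) col (suc zero) refl

-- Decided by evaluation as above: all 25 products normalise to numerals, uniformly in ν.
lower-right : ∀ ν (d k : Fin 5) → blk (toℕ d) (toℕ k) ≡ lowerRow ν d ⊙ rightCol ν k
lower-right ν =
  toWitness {a? = all? λ d → all? λ k → blk (toℕ d) (toℕ k) ≟ lowerRow ν d ⊙ rightCol ν k} _

Centry≡⊙ : ∀ {ν μ r c} → μ ≤ ν → (rb : RowBlock ν μ r) (cb : ColBlock ν μ c) →
  Centry ν (suc r) (suc c) ≡ rowVector rb ⊙ colVector cb
Centry≡⊙ {ν} μ≤ν (before {r} r<μ) (before {c} c<μ) =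
  trans (Centry-top {ν} (<⇒≤ (<-≤-trans r<μ μ≤ν)) (<-≤-trans c<μ μ≤ν))
        (band-exact (3 + 10 * r) r (7 + 10 * c) c (diag-split 3 7 r c refl))
Centry≡⊙ {ν} μ≤ν (before {r} r<μ) (after {c} μ<c c<ν) =
  trans (Centry-top {ν} (<⇒≤ (<-≤-trans r<μ μ≤ν)) c<ν)
        (band-rowTerm (3 + 10 * r) r (8 + 10 * c) c 2+r≤c (rowTerm≤ 3 8 2 (≤ᵇ⇒≤ 21 31 _) 2+r≤c))
  where 2+r≤c = ≤-<-trans r<μ μ<c
Centry≡⊙ {ν} μ≤ν (before {r} r<μ) (last μ<ν) =
  trans (Centry-top-lastCol {ν} (≤-<-trans r<μ μ<ν))
        (band-exact (3 + 10 * r) r (7 + 10 * ν) ν (diag-split 3 7 r ν refl))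
Centry≡⊙ {ν} μ≤ν (before {r} r<μ) (right zero) =
  trans (Centry-top-right₀ {ν} (<⇒≤ r<ν))
        (band-rowTerm (3 + 10 * r) r (9 + 10 * ν) (suc ν) (s≤s r<ν)
                      (rowTerm≤ 3 9 1 (≤ᵇ⇒≤ 21 22 _) r<ν))
  where r<ν = <-≤-trans r<μ μ≤ν
Centry≡⊙ μ≤ν (before {r} r<μ) (right (suc k)) =
  top-right (1 + 10 * r) (<⇒≤ (<-≤-trans r<μ μ≤ν)) k
Centry≡⊙ {ν} μ≤ν (after {r} μ≤r r<ν) (before {c} c<μ) =
  trans (Centry-top {ν} (<⇒≤ r<ν) (<-≤-trans c<μ μ≤ν))
        (band-colTerm (2 + 10 * r) r (7 + 10 * c) c c<r (colTerm≤ 2 7 1 (≤ᵇ⇒≤ 11 19 _) c<r))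
  where c<r = <-≤-trans c<μ μ≤r
Centry≡⊙ {ν} _ (after {r} _ r<ν) (after {c} _ c<ν) =
  trans (Centry-top {ν} (<⇒≤ r<ν) c<ν)
        (band-exact (2 + 10 * r) r (8 + 10 * c) c (diag-split 2 8 r c refl))
Centry≡⊙ {ν} _ (after {r} _ r<ν) (last _) with m≤n⇒m<n∨m≡n r<ν
... | inj₁ 2+r≤ν =
  trans (Centry-top-lastCol {ν} 2+r≤ν)
        (band-rowTerm (2 + 10 * r) r (7 + 10 * ν) ν 2+r≤ν
                      (rowTerm≤ 2 7 2 (≤ᵇ⇒≤ 21 29 _) 2+r≤ν))
... | inj₂ refl = penultimate-entry r
Centry≡⊙ {ν} _ (after {r} _ r<ν) (right zero) =
  trans (Centry-top-right₀ {ν} (<⇒≤ r<ν))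
        (band-rowTerm (2 + 10 * r) r (9 + 10 * ν) (suc ν) (s≤s r<ν)
                      (rowTerm≤ 2 9 1 (≤ᵇ⇒≤ 21 21 _) r<ν))
Centry≡⊙ _ (after {r} _ r<ν) (right (suc k)) = top-right (10 * r) (<⇒≤ r<ν) k
Centry≡⊙ {ν} μ≤ν last (before {c} c<μ) =
  trans (Centry-top {ν} ≤-refl c<ν)
        (band-colTerm (11 + 10 * ν) ν (7 + 10 * c) c c<ν (colTerm≤ 11 7 1 (≤ᵇ⇒≤ 11 28 _) c<ν))
  where c<ν = <-≤-trans c<μ μ≤ν
Centry≡⊙ {ν} _ last (after {c} _ c<ν) =
  trans (Centry-top {ν} ≤-refl c<ν)
        (band-colTerm (11 + 10 * ν) ν (8 + 10 * c) c c<ν (colTerm≤ 11 8 1 (≤ᵇ⇒≤ 11 29 _) c<ν))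
Centry≡⊙ {ν} _ last (last _) = last-last-entry ν
Centry≡⊙ {ν} _ last (right zero) =
  trans (Centry-top-right₀ {ν} ≤-refl)
        (band-exact (11 + 10 * ν) ν (9 + 10 * ν) (suc ν) (last-right₀ ν))
Centry≡⊙ {ν} _ last (right (suc k)) = top-right (9 + 10 * ν) ≤-refl k
Centry≡⊙ μ≤ν (lower d) (before c<μ) = lower-nearCol d (<⇒≤ (<-≤-trans c<μ μ≤ν))
Centry≡⊙ _ (lower d) (after μ<c c<ν) = lower-afterCol d (≤-<-trans z≤n μ<c) (<⇒≤ c<ν)
Centry≡⊙ _ (lower d) (last _) = lower-nearCol d ≤-refl
Centry≡⊙ {ν} _ (lower d) (right k) =
  trans (Centry-lower-right {ν} (toℕ d) (toℕ k)) (lower-right ν d k)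

theorem5p3 : (ν : ℕ) → 1 < ν → (μ : Fin (6 + ν)) → toℕ μ < suc ν →
    FactorRankAtMost 4 (removeCol μ (C ν))
theorem5p3 ν _ μ μ<1+ν =
  4 , ≤-refl , tropical-factorization A B D (λ i j → Centry≡⊙ μ≤ν (rb i) (cb j))
  where
  μ≤ν = s≤s⁻¹ μ<1+ν
  A : Fin (6 + ν) → Fin (5 + ν) → ℕ
  A i j = Centry ν (suc (toℕ i)) (suc (toℕ (punchIn μ j)))
  rb : (i : Fin (6 + ν)) → RowBlock ν (toℕ μ) (toℕ i)
  rb i = rowBlock ν (toℕ μ) (toℕ i) (toℕ<n i)
  cb : (j : Fin (5 + ν)) → ColBlock ν (toℕ μ) (toℕ (punchIn μ j))
  cb j = colBlock ν (toℕ μ) (toℕ (punchIn μ j)) (toℕ<n (punchIn μ j))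
                  (punchInᵢ≢i μ j ∘ toℕ-injective)
  B : Fin (6 + ν) → Fin 4 → ℕ
  B i = rowVector (rb i)
  D : Fin (5 + ν) → Fin 4 → ℕ
  D j = colVector (cb j)
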